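{- Let $G$ be a $4$-critical graph with no $(7,2)$-colouring such that $D_3(G)$ contains no odd cycle. Then there do not exist two distinct vertices $u,v$ of degree $3$ with $N[u]=N[v]$.
   Context: A graph is $4$-critical if its chromatic number is $4$ but every proper subgraph is $3$-colourable. A $(7,2)$-colouring is a map $f:V(G)\to\{0,\dots,6\}$ with $2\le|f(a)-f(b)|\le5$ for every edge $ab$. $D_3(G)$ is the subgraph induced by the vertices of degree $3$. $N[v]=N(v)\cup\{v\}$ is the closed neighbourhood. -}

module Defs where

open import Data.Nat using (ℕ; zero; suc; _≤_; _<_; ∣_-_∣)
open import Data.Fin using (Fin; toℕ)
open import Data.Bool using (Bool; T)
open import Data.Bool.Properties using (T?)
open import Data.List using (List; length; filter)
open import Data.List.Base using ()
open import Data.Fin.Base using ()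
open import Data.Product using (Σ; ∃; ∃-syntax; _×_; _,_)
open import Data.Sum using (_⊎_)
open import Data.Empty using (⊥)
open import Relation.Nullary using (¬_)
open import Relation.Binary.PropositionalEquality using (_≡_; _≢_)
open import Function.Bundles using (_⇔_)
open import Data.List using (allFin)

record Graph : Set where
  field
    n      : ℕ
    adj    : Fin n → Fin n → Bool
    sym    : ∀ u v → T (adj u v) → T (adj v u)
    irrefl : ∀ v → ¬ T (adj v v)

open Graph public

_~[_]_ : {n : ℕ} → Fin n → (Fin n → Fin n → Bool) → Fin n → Set
u ~[ a ] v = T (a u v)

Adj : (G : Graph) → Fin (n G) → Fin (n G) → Set
Adj G u v = T (adj G u v)

degree : (G : Graph) → Fin (n G) → ℕ
degree G v = length (filter (λ w → T? (adj G v w)) (allFin (n G)))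

Colourable : (G : Graph) → ℕ → Set
Colourable G k = Σ (Fin (n G) → Fin k) λ f → ∀ u v → Adj G u v → f u ≢ f v

ChromaticNumber : (G : Graph) → ℕ → Set
ChromaticNumber G k = Colourable G k × (∀ j → j < k → ¬ Colourable G j)

record Subgraph (G : Graph) : Set where
  field
    S     : Fin (n G) → Bool
    E     : Fin (n G) → Fin (n G) → Bool
    E-sym : ∀ u v → T (E u v) → T (E v u)
    E⊆    : ∀ u v → T (E u v) → Adj G u v
    E-end : ∀ u v → T (E u v) → T (S u) × T (S v)

open Subgraph public

Proper : {G : Graph} → Subgraph G → Set
Proper {G} H = (∃[ v ] ¬ T (S H v)) ⊎ (∃[ u ] ∃[ v ] (Adj G u v × ¬ T (E H u v)))

-- k-colouring of the subgraph H (colours on vertices outside S irrelevant)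
SubColourable : {G : Graph} → Subgraph G → ℕ → Set
SubColourable {G} H k =
  Σ (Fin (n G) → Fin k) λ f → ∀ u v → T (E H u v) → f u ≢ f v

Critical : ℕ → Graph → Set
Critical k G = ChromaticNumber G k ×
  (∀ (H : Subgraph G) → Proper H → ∀ j → suc j ≡ k → SubColourable H j)

Colouring72 : Graph → Set
Colouring72 G = Σ (Fin (n G) → Fin 7) λ f →
  ∀ a b → Adj G a b → 2 ≤ ∣ toℕ (f a) - toℕ (f b) ∣ × ∣ toℕ (f a) - toℕ (f b) ∣ ≤ 5

InD3 : (G : Graph) → Fin (n G) → Set
InD3 G v = degree G v ≡ 3

record Cycle (G : Graph) (k : ℕ) : Set where
  field
    three≤ : 3 ≤ k
    c      : Fin k → Fin (n G)
    inj    : ∀ i j → c i ≡ c j → i ≡ j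
    step   : ∀ (i j : Fin k) →
             (suc (toℕ i) ≡ toℕ j ⊎ (suc (toℕ i) ≡ k × toℕ j ≡ 0)) →
             Adj G (c i) (c j)

open Cycle public

-- D_3(G) contains an odd cycle: a cycle of odd length all of whose
-- vertices have degree 3 in G (a cycle in the induced subgraph D_3(G)).
D3HasOddCycle : Graph → Set
D3HasOddCycle G = ∃[ m ] Σ (Cycle G (suc (m Data.Nat.+ m))) λ C →
  ∀ i → InD3 G (c C i)

ClosedNbhd : (G : Graph) → Fin (n G) → Fin (n G) → Set
ClosedNbhd G u w = w ≡ u ⊎ Adj G u w

SameClosedNbhd : (G : Graph) → Fin (n G) → Fin (n G) → Set
SameClosedNbhd G u v = ∀ w → ClosedNbhd G u w ⇔ ClosedNbhd G v w

-- Twins u, v of degree 3 are adjacent and have two further common neighbours x and y.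
-- If x ~ y then uvxy is a K4, and a K4 in a 4-critical graph has no neighbour outside
-- itself (deleting the edge to one would leave a 3-colourable graph containing K4); so x has
-- degree 3 and uvx is a triangle in D3(G).  If x ≁ y, 3-colour G − vx: criticality forces
-- c(v) = c(x), hence c(x) ≠ c(y), and placing u, v, x, y at 4, 6, 1, 2 and the colour classes
-- of x, of y and the third class at 0, 3, 5 is a (7,2)-colouring.
module Submission where

open import Defs hiding (sym)
open import Data.Product using (_×_; ∃-syntax)
open import Relation.Nullary using (¬_)
open import Relation.Binary.PropositionalEquality using (_≢_)

open import Data.Bool using (true)
open import Data.Bool.Properties using (T?)
open import Data.Empty using (⊥-elim)
open import Data.Fin using (Fin; zero; suc; toℕ; inject₁; #_)
open import Data.Fin.Properties using (_≟_; any?; pigeonhole; <⇒≢; inject₁-injective)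
open import Data.List using (List; []; _∷_; length; filter; allFin)
open import Data.List.Membership.Propositional using (_∈_; _∉_)
open import Data.List.Membership.Propositional.Properties using (∈-filter⁺; ∈-filter⁻; ∈-allFin; ∈-∃++)
open import Data.List.Membership.Propositional.Properties.WithK using (unique∧set⇒bag)
open import Data.List.Relation.Binary.BagAndSetEquality using (∼bag⇒↭)
open import Data.List.Relation.Binary.Permutation.Propositional using (_↭_; ↭-sym; ↭⇒↭ₛ)
open import Data.List.Relation.Binary.Permutation.Propositional.Properties using (↭-length; shift; ∈-resp-↭)
open import Data.List.Relation.Binary.Permutation.Setoid.Properties using (AllPairs-resp-↭)
open import Data.List.Relation.Unary.All as All using ([]; _∷_)
open import Data.List.Relation.Unary.Any using (here; there)
open import Data.List.Relation.Unary.AllPairs using ([]; _∷_)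
open import Data.List.Relation.Unary.Unique.Propositional using (Unique)
open import Data.List.Relation.Unary.Unique.Propositional.Properties using (filter⁺; allFin⁺)
open import Data.Nat using (suc; _≤_; _≤?_; s≤s; z≤n; ∣_-_∣)
open import Data.Nat.Properties using (suc-injective; n<1+n; 1+n≢n)
open import Data.Product using (_,_; proj₁; proj₂; ∃; ∃₂)
open import Data.Sum using (_⊎_; inj₁; inj₂; [_,_])
open import Data.Unit using (tt)
open import Data.Vec using ([]; _∷_; lookup)
open import Function using (_∘_)
open import Function.Bundles using (_⇔_; mk⇔; module Equivalence)
open import Relation.Binary using (Symmetric)
open import Relation.Binary.PropositionalEquality using (_≡_; refl; sym; trans; subst; cong; ≢-sym; resp₂; setoid)
open import Relation.Nullary using (Dec; yes; no; ¬?; contradiction)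
open import Relation.Nullary.Decidable using (_×-dec_; _⊎-dec_; isYes; True; toWitness; fromWitness; decidable-stable)

open Equivalence using (to; from)

private
  variable
    A : Set

Unique-resp-↭ : {xs ys : List A} → xs ↭ ys → Unique xs → Unique ys
Unique-resp-↭ {A = A} p = AllPairs-resp-↭ (setoid A) ≢-sym (resp₂ _≢_) (↭⇒↭ₛ p)

∈⇒↭-front : ∀ {v : A} {xs} → v ∈ xs → ∃ λ ys → xs ↭ v ∷ ys
∈⇒↭-front {v = v} v∈xs with ys , zs , refl ← ∈-∃++ v∈xs = _ , shift v ys zs

length≡2 : {ys : List A} → length ys ≡ 2 → ∃₂ λ x y → ys ≡ x ∷ y ∷ []
length≡2 {ys = x ∷ y ∷ []} refl = x , y , refl

module _ {R : A → A → Set} (R-sym : Symmetric R) {a b c d : A}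
         (ab : R a b) (ac : R a c) (ad : R a d) (bc : R b c) (bd : R b d) (cd : R c d) where

  pairwise4 : ∀ {i j} → i ≢ j → R (lookup (a ∷ b ∷ c ∷ d ∷ []) i) (lookup (a ∷ b ∷ c ∷ d ∷ []) j)
  pairwise4 {zero}                {zero}                i≢j = contradiction refl i≢j
  pairwise4 {zero}                {suc zero}            _   = ab
  pairwise4 {zero}                {suc (suc zero)}      _   = ac
  pairwise4 {zero}                {suc (suc (suc zero))} _  = ad
  pairwise4 {suc zero}            {zero}                _   = R-sym ab
  pairwise4 {suc zero}            {suc zero}            i≢j = contradiction refl i≢j
  pairwise4 {suc zero}            {suc (suc zero)}      _   = bc
  pairwise4 {suc zero}            {suc (suc (suc zero))} _  = bd
  pairwise4 {suc (suc zero)}      {zero}                _   = R-sym ac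
  pairwise4 {suc (suc zero)}      {suc zero}            _   = R-sym bc
  pairwise4 {suc (suc zero)}      {suc (suc zero)}      i≢j = contradiction refl i≢j
  pairwise4 {suc (suc zero)}      {suc (suc (suc zero))} _  = cd
  pairwise4 {suc (suc (suc zero))} {zero}               _   = R-sym ad
  pairwise4 {suc (suc (suc zero))} {suc zero}           _   = R-sym bd
  pairwise4 {suc (suc (suc zero))} {suc (suc zero)}     _   = R-sym cd
  pairwise4 {suc (suc (suc zero))} {suc (suc (suc zero))} i≢j = contradiction refl i≢j

Fin3-third-unique : {a b c d : Fin 3} → a ≢ b → c ≢ a → c ≢ b → d ≢ a → d ≢ b → c ≡ d
Fin3-third-unique {a} {b} {c} {d} a≢b c≢a c≢b d≢a d≢b = decidable-stable (c ≟ d) λ c≢d →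
  let (i , j , i<j , same) = pigeonhole (n<1+n 3) (lookup (a ∷ b ∷ c ∷ d ∷ [])) in
  pairwise4 {R = _≢_} ≢-sym a≢b (≢-sym c≢a) (≢-sym d≢a) (≢-sym c≢b) (≢-sym d≢b) c≢d (<⇒≢ i<j) same

Far₇ : Fin 7 → Fin 7 → Set
Far₇ i j = 2 ≤ ∣ toℕ i - toℕ j ∣ × ∣ toℕ i - toℕ j ∣ ≤ 5

far₇? : ∀ i j → Dec (Far₇ i j)
far₇? i j = 2 ≤? ∣ toℕ i - toℕ j ∣ ×-dec ∣ toℕ i - toℕ j ∣ ≤? 5

critical⇒¬colourable : ∀ {k G} → Critical (suc k) G → ¬ Colourable G k
critical⇒¬colourable {k} crit = proj₂ (proj₁ crit) k (n<1+n k)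

module _ (G : Graph) where

  private
    V : Set
    V = Fin (n G)

  Adj-sym : ∀ {a b} → Adj G a b → Adj G b a
  Adj-sym = Graph.sym G _ _

  Adj-irrefl : ∀ {a b} → Adj G a b → a ≢ b
  Adj-irrefl {a} a~b refl = irrefl G a a~b

  neighbours : V → List V
  neighbours u = filter (λ w → T? (adj G u w)) (allFin (n G))

  record IsNeighbourList (u : V) (ws : List V) : Set where
    field
      unique  : Unique ws
      members : ∀ {w} → w ∈ ws ⇔ Adj G u w

  open IsNeighbourList

  neighbours-isNeighbourList : ∀ u → IsNeighbourList u (neighbours u)
  neighbours-isNeighbourList u = record
    { unique  = filter⁺ P? (allFin⁺ (n G))
    ; members = mk⇔ (λ w∈ → proj₂ (∈-filter⁻ P? {xs = allFin (n G)} w∈)) (∈-filter⁺ P? (∈-allFin _))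
    }
    where P? = λ w → T? (adj G u w)

  IsNeighbourList-resp-↭ : ∀ {u ws ws′} → ws ↭ ws′ → IsNeighbourList u ws → IsNeighbourList u ws′
  IsNeighbourList-resp-↭ p N = record
    { unique  = Unique-resp-↭ p (unique N)
    ; members = mk⇔ (to (members N) ∘ ∈-resp-↭ (↭-sym p)) (∈-resp-↭ p ∘ from (members N))
    }

  degree≡length : ∀ {u ws} → IsNeighbourList u ws → degree G u ≡ length ws
  degree≡length {u} N = ↭-length (∼bag⇒↭ (unique∧set⇒bag (unique N′) (unique N)
    (mk⇔ (from (members N) ∘ to (members N′)) (from (members N′) ∘ to (members N)))))
    where N′ = neighbours-isNeighbourList u

  degree3⇒neighbourList : ∀ {u v} → InD3 G u → Adj G u v → ∃₂ λ x y → IsNeighbourList u (v ∷ x ∷ y ∷ [])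
  degree3⇒neighbourList {u} du u~v
    with N ← neighbours-isNeighbourList u
    with ys , p ← ∈⇒↭-front (from (members N) u~v)
    with x , y , refl ← length≡2 {ys = ys} (suc-injective (trans (sym (↭-length p)) du))
    = x , y , IsNeighbourList-resp-↭ p N

  twins-adjacent : ∀ {u v} → SameClosedNbhd G u v → u ≢ v → Adj G u v
  twins-adjacent {u} {v} same u≢v with from (same v) (inj₁ refl)
  ... | inj₁ v≡u = contradiction (sym v≡u) u≢v
  ... | inj₂ u~v = u~v

  twins-neighbourList : ∀ {u v ws} → SameClosedNbhd G u v → u ≢ v →
    IsNeighbourList u (v ∷ ws) → IsNeighbourList v (u ∷ ws)
  twins-neighbourList {u} {v} {ws} same u≢v N = record
    { unique  = All.tabulate (Adj-irrefl ∘ to (members N) ∘ there) ∷ unique-ws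
    ; members = mk⇔ to′ from′
    }
    where
    v∉ws : v ∉ ws
    v∉ws v∈ws with v≢ws ∷ _ ← unique N = All.lookup v≢ws v∈ws refl
    unique-ws : Unique ws
    unique-ws with _ ∷ u-ws ← unique N = u-ws
    to′ : ∀ {w} → w ∈ u ∷ ws → Adj G v w
    to′ (here refl)  = Adj-sym (twins-adjacent same u≢v)
    to′ (there w∈ws) with to (same _) (inj₂ (to (members N) (there w∈ws)))
    ... | inj₁ refl = contradiction w∈ws v∉ws
    ... | inj₂ v~w  = v~w
    from′ : ∀ {w} → Adj G v w → w ∈ u ∷ ws
    from′ v~w with from (same _) (inj₂ v~w)
    ... | inj₁ refl = here refl
    ... | inj₂ u~w with from (members N) u~w
    ...   | here refl  = contradiction refl (Adj-irrefl v~w)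
    ...   | there w∈ws = there w∈ws

  withoutEdge : V → V → Subgraph G
  withoutEdge p q = record
    { S     = λ _ → true
    ; E     = λ a b → isYes (kept? a b)
    ; E-sym = λ a b t → let (a~b , ¬both) = toWitness t in
        fromWitness (Adj-sym a~b , λ (b∈ , a∈) → ¬both (a∈ , b∈))
    ; E⊆   = λ a b t → proj₁ (toWitness t)
    ; E-end = λ _ _ _ → _ , _
    }
    where
    kept? : ∀ a b → Dec (Adj G a b × ¬ ((a ≡ p ⊎ a ≡ q) × (b ≡ p ⊎ b ≡ q)))
    kept? a b = T? (adj G a b) ×-dec ¬? ((a ≟ p ⊎-dec a ≟ q) ×-dec (b ≟ p ⊎-dec b ≟ q))

  withoutEdge-proper : ∀ {p q} → Adj G p q → Proper (withoutEdge p q)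
  withoutEdge-proper {p} {q} p~q = inj₂ (p , q , p~q , λ t → proj₂ (toWitness t) (inj₁ refl , inj₂ refl))

  -- Every edge other than pq has an endpoint outside {p, q}, so this says c is proper on G − pq.
  ProperOffEdge : V → V → ∀ {k} → (V → Fin k) → Set
  ProperOffEdge p q c = ∀ {a b} → Adj G a b → a ≢ p → a ≢ q → c a ≢ c b

  critical⇒properOffEdge : ∀ {k p q} → Critical (suc k) G → Adj G p q → ∃ λ c → ProperOffEdge p q {k} c
  critical⇒properOffEdge {k} {p} {q} crit p~q
    with c , proper ← proj₂ crit (withoutEdge p q) (withoutEdge-proper p~q) k refl
    = c , λ a~b a≢p a≢q → proper _ _ (fromWitness (a~b , λ (a∈ , _) → [ a≢p , a≢q ] a∈))

  properOffEdge⇒sameColour : ∀ {k p q} {c : V → Fin k} → ¬ Colourable G k → ProperOffEdge p q c → c p ≡ c q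
  properOffEdge⇒sameColour {p = p} {q} {c} ¬col proper =
    decidable-stable (c p ≟ c q) (λ c[p]≢c[q] → ¬col (c , properEverywhere c[p]≢c[q]))
    where
    properEverywhere : c p ≢ c q → ∀ a b → Adj G a b → c a ≢ c b
    properEverywhere c[p]≢c[q] a b a~b with a ≟ p | a ≟ q | b ≟ p | b ≟ q
    ... | no a≢p   | no a≢q   | _        | _        = proper a~b a≢p a≢q
    ... | _        | _        | no b≢p   | no b≢q   = ≢-sym (proper (Adj-sym a~b) b≢p b≢q)
    ... | yes refl | _        | _        | yes refl = c[p]≢c[q]
    ... | _        | yes refl | yes refl | _        = ≢-sym c[p]≢c[q]
    ... | yes refl | _        | yes refl | _        = contradiction refl (Adj-irrefl a~b)
    ... | _        | yes refl | _        | yes refl = contradiction refl (Adj-irrefl a~b)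

  IsClique : ∀ {m} → (Fin m → V) → Set
  IsClique K = ∀ {i j} → i ≢ j → Adj G (K i) (K j)

  clique-¬properOffEdge : ∀ {k} (K : Fin (suc k) → V) → IsClique K → ∀ {i w} → (∀ j → w ≢ K j) →
    (c : V → Fin k) → ¬ ProperOffEdge (K i) w c
  clique-¬properOffEdge {k} K clique {i} w∉K c proper
    with j , j′ , j<j′ , c[Kj]≡c[Kj′] ← pigeonhole (n<1+n k) (c ∘ K)
    with j ≟ i
  ... | no j≢i   = proper (clique (<⇒≢ j<j′)) (Adj-irrefl (clique j≢i)) (w∉K j ∘ sym) c[Kj]≡c[Kj′]
  ... | yes refl = proper (clique j′≢j) (Adj-irrefl (clique j′≢j)) (w∉K j′ ∘ sym) (sym c[Kj]≡c[Kj′])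
    where j′≢j = ≢-sym (<⇒≢ j<j′)

  critical-clique-closed : ∀ {k} → Critical (suc k) G → (K : Fin (suc k) → V) → IsClique K →
    ∀ {i w} → Adj G (K i) w → ∃ λ j → w ≡ K j
  critical-clique-closed crit K clique Ki~w with any? (λ j → _ ≟ K j)
  ... | yes w∈K = w∈K
  ... | no w∉K with c , proper ← critical⇒properOffEdge crit Ki~w
    = ⊥-elim (clique-¬properOffEdge K clique (λ j w≡Kj → w∉K (j , w≡Kj)) c proper)

  clique⇒cycle : ∀ {m} {K : Fin m → V} → 3 ≤ m → IsClique K → Cycle G m
  clique⇒cycle {m} {K} 3≤m clique = record { three≤ = 3≤m ; c = K ; inj = K-injective ; step = K-step }
    where
    K-injective : ∀ i j → K i ≡ K j → i ≡ j
    K-injective i j Ki≡Kj = decidable-stable (i ≟ j) (λ i≢j → Adj-irrefl (clique i≢j) Ki≡Kj)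
    m≢1 : m ≢ 1
    m≢1 m≡1 = contradiction (subst (3 ≤_) m≡1 3≤m) λ { (s≤s ()) }
    K-step : ∀ i j → suc (toℕ i) ≡ toℕ j ⊎ (suc (toℕ i) ≡ m × toℕ j ≡ 0) → Adj G (K i) (K j)
    K-step i j (inj₁ next)           = clique λ { refl → 1+n≢n next }
    K-step i j (inj₂ (last , first)) = clique λ { refl → m≢1 (trans (sym last) (cong suc first)) }

  critical-K4-degree3 : Critical 4 G → ∀ {u v x y} → IsClique (lookup (u ∷ v ∷ x ∷ y ∷ [])) → InD3 G x
  critical-K4-degree3 crit {u} {v} {x} {y} K4 = degree≡length (record
    { unique  = (Adj-irrefl u~v ∷ Adj-irrefl u~y ∷ []) ∷ (Adj-irrefl v~y ∷ []) ∷ [] ∷ []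
    ; members = mk⇔ to′ from′
    })
    where
    u~v = K4 {# 0} {# 1} λ ()
    u~y = K4 {# 0} {# 3} λ ()
    v~y = K4 {# 1} {# 3} λ ()
    to′ : ∀ {w} → w ∈ u ∷ v ∷ y ∷ [] → Adj G x w
    to′ (here refl)                 = K4 {# 2} {# 0} λ ()
    to′ (there (here refl))         = K4 {# 2} {# 1} λ ()
    to′ (there (there (here refl))) = K4 {# 2} {# 3} λ ()
    from′ : ∀ {w} → Adj G x w → w ∈ u ∷ v ∷ y ∷ []
    from′ x~w with critical-clique-closed crit _ K4 {# 2} x~w
    ... | zero , refl                 = here refl
    ... | suc zero , refl             = there (here refl)
    ... | suc (suc zero) , refl       = contradiction refl (Adj-irrefl x~w)
    ... | suc (suc (suc zero)) , refl = there (there (here refl))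

  critical-twins⇒D3HasOddCycle : Critical 4 G → ∀ {u v x y} →
    IsNeighbourList u (v ∷ x ∷ y ∷ []) → IsNeighbourList v (u ∷ x ∷ y ∷ []) → Adj G x y →
    InD3 G u → InD3 G v → D3HasOddCycle G
  critical-twins⇒D3HasOddCycle crit {u} {v} {x} {y} Nu Nv x~y du dv =
    1 , clique⇒cycle (s≤s (s≤s (s≤s z≤n))) triangle ,
    λ { zero → du ; (suc zero) → dv ; (suc (suc zero)) → critical-K4-degree3 crit K4 }
    where
    K4 : IsClique (lookup (u ∷ v ∷ x ∷ y ∷ []))
    K4 = pairwise4 Adj-sym {u} {v} {x} {y}
           (to (members Nu) (here refl)) (to (members Nu) (there (here refl))) (to (members Nu) (there (there (here refl))))
           (to (members Nv) (there (here refl))) (to (members Nv) (there (there (here refl)))) x~y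
    triangle : IsClique (lookup (u ∷ v ∷ x ∷ y ∷ []) ∘ inject₁)
    triangle i≢j = K4 (i≢j ∘ inject₁-injective)

  open import Data.List.Membership.DecPropositional (_≟_ {n G}) using (_∈?_)

  pattern at-u = yes (here refl)
  pattern at-v = yes (there (here refl))
  pattern at-x = yes (there (there (here refl)))
  pattern at-y = yes (there (there (there (here refl))))

  module _ {u v x y : V} where

    private
      quad : List V
      quad = u ∷ v ∷ x ∷ y ∷ []

    threeColouring⇒colouring72 :
      (∀ {w} → Adj G u w → w ∈ quad) → (∀ {w} → Adj G v w → w ∈ quad) → ¬ Adj G x y →
      (c : V → Fin 3) → c x ≢ c y → (∀ {a b} → Adj G a b → a ∉ quad → c a ≢ c b) → Colouring72 G
    threeColouring⇒colouring72 closed-u closed-v x≁y c c[x]≢c[y] proper =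
      (λ w → label (w ∈? quad)) , λ a b a~b → toWitness (far (a ∈? quad) (b ∈? quad) a~b)
      where
      classLabel : Fin 3 → Fin 7
      classLabel k with k ≟ c x | k ≟ c y
      ... | yes _ | _     = # 0
      ... | no _  | yes _ = # 3
      ... | no _  | no _  = # 5

      label : ∀ {w} → Dec (w ∈ quad) → Fin 7
      label (yes (here _))                         = # 4
      label (yes (there (here _)))                 = # 6
      label (yes (there (there (here _))))         = # 1
      label (yes (there (there (there (here _))))) = # 2
      label {w} (no _)                             = classLabel (c w)

      far-x : ∀ {k} → k ≢ c x → True (far₇? (# 1) (classLabel k)) × True (far₇? (classLabel k) (# 1))
      far-x {k} k≢c[x] with k ≟ c x | k ≟ c y
      ... | yes k≡c[x] | _ = contradiction k≡c[x] k≢c[x]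
      ... | no _ | yes _   = tt , tt
      ... | no _ | no _    = tt , tt

      far-y : ∀ {k} → k ≢ c y → True (far₇? (# 2) (classLabel k)) × True (far₇? (classLabel k) (# 2))
      far-y {k} k≢c[y] with k ≟ c x | k ≟ c y
      ... | yes _ | _          = tt , tt
      ... | no _ | yes k≡c[y]  = contradiction k≡c[y] k≢c[y]
      ... | no _ | no _        = tt , tt

      far-classes : ∀ {k k′} → k ≢ k′ → True (far₇? (classLabel k) (classLabel k′))
      far-classes {k} {k′} k≢k′ with k ≟ c x | k ≟ c y | k′ ≟ c x | k′ ≟ c y
      ... | yes refl | _        | yes refl | _        = contradiction refl k≢k′
      ... | yes _    | _        | no _     | yes _    = tt
      ... | yes _    | _        | no _     | no _     = tt
      ... | no _     | yes _    | yes _    | _        = tt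
      ... | no _     | yes refl | no _     | yes refl = contradiction refl k≢k′
      ... | no _     | yes _    | no _     | no _     = tt
      ... | no _     | no _     | yes _    | _        = tt
      ... | no _     | no _     | no _     | yes _    = tt
      ... | no k≢x   | no k≢y   | no k′≢x  | no k′≢y  =
        contradiction (Fin3-third-unique c[x]≢c[y] k≢x k≢y k′≢x k′≢y) k≢k′

      far : ∀ {a b} (a? : Dec (a ∈ quad)) (b? : Dec (b ∈ quad)) → Adj G a b → True (far₇? (label a?) (label b?))
      far at-u at-u a~b = contradiction refl (Adj-irrefl a~b)
      far at-u at-v _   = tt
      far at-u at-x _   = tt
      far at-u at-y _   = tt
      far at-u (no b∉) a~b = contradiction (closed-u a~b) b∉
      far at-v at-u _   = tt
      far at-v at-v a~b = contradiction refl (Adj-irrefl a~b)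
      far at-v at-x _   = tt
      far at-v at-y _   = tt
      far at-v (no b∉) a~b = contradiction (closed-v a~b) b∉
      far at-x at-u _   = tt
      far at-x at-v _   = tt
      far at-x at-x a~b = contradiction refl (Adj-irrefl a~b)
      far at-x at-y a~b = contradiction a~b x≁y
      far at-x (no b∉) a~b = proj₁ (far-x (proper (Adj-sym a~b) b∉))
      far at-y at-u _   = tt
      far at-y at-v _   = tt
      far at-y at-x a~b = contradiction (Adj-sym a~b) x≁y
      far at-y at-y a~b = contradiction refl (Adj-irrefl a~b)
      far at-y (no b∉) a~b = proj₁ (far-y (proper (Adj-sym a~b) b∉))
      far (no a∉) at-u a~b = contradiction (closed-u (Adj-sym a~b)) a∉
      far (no a∉) at-v a~b = contradiction (closed-v (Adj-sym a~b)) a∉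
      far (no a∉) at-x a~b = proj₂ (far-x (proper a~b a∉))
      far (no a∉) at-y a~b = proj₂ (far-y (proper a~b a∉))
      far (no a∉) (no b∉) a~b = far-classes (proper a~b a∉)

  critical-twins⇒colouring72 : Critical 4 G → ∀ {u v x y} →
    IsNeighbourList u (v ∷ x ∷ y ∷ []) → IsNeighbourList v (u ∷ x ∷ y ∷ []) → ¬ Adj G x y → Colouring72 G
  critical-twins⇒colouring72 crit {u} {v} {x} {y} Nu Nv x≁y =
    let c , proper = critical⇒properOffEdge crit v~x
        c[v]≡c[x]  = properOffEdge⇒sameColour (critical⇒¬colourable crit) proper
    in threeColouring⇒colouring72 (there ∘ from (members Nu)) (into-quad ∘ from (members Nv)) x≁y c
         (λ c[x]≡c[y] → proper (Adj-sym v~y) (Adj-irrefl (Adj-sym v~y)) (≢-sym x≢y)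
                          (sym (trans c[v]≡c[x] c[x]≡c[y])))
         (λ a~b a∉ → proper a~b (a∉ ∘ there ∘ here) (a∉ ∘ there ∘ there ∘ here))
    where
    v~x = to (members Nv) (there (here refl))
    v~y = to (members Nv) (there (there (here refl)))
    x≢y : x ≢ y
    x≢y with _ ∷ (x≢y ∷ []) ∷ _ ← unique Nu = x≢y
    into-quad : ∀ {w} → w ∈ u ∷ x ∷ y ∷ [] → w ∈ u ∷ v ∷ x ∷ y ∷ []
    into-quad (here w≡u)   = here w≡u
    into-quad (there w∈xy) = there (there w∈xy)

proposition7p1 : (G : Graph) → Critical 4 G → ¬ Colouring72 G → ¬ D3HasOddCycle G →
    ¬ (∃[ u ] ∃[ v ] (u ≢ v × InD3 G u × InD3 G v × SameClosedNbhd G u v))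
proposition7p1 G crit no72 noOdd (u , v , u≢v , du , dv , same)
  with x , y , Nu ← degree3⇒neighbourList G du (twins-adjacent G same u≢v)
  with Nv ← twins-neighbourList G same u≢v Nu
  with T? (adj G x y)
... | yes x~y = noOdd (critical-twins⇒D3HasOddCycle G crit Nu Nv x~y du dv)
... | no x≁y  = no72 (critical-twins⇒colouring72 G crit Nu Nv x≁y)
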